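{- Let $\Sigma$ be a signature and $E$ an equational theory inducing a convergent, subterm convergent rewrite system, and let processes, the relevant-term extraction $\vdash_k$ and the satisfaction relation $P \models \mathbb{K}\phi$ be as described in the context. For every process $P$ and every finite set of terms $\phi$, it is decidable whether $P \models \mathbb{K}\phi$.
   Context: Terms $T ::= n \mid x \mid f(T_1,\dots,T_a)$ are built from names $n$, variables $x$ and function symbols $f\in\Sigma$. An equational theory $E$ is a set of equations $t=s$; orienting them gives a convergent, subterm convergent rewrite system (each right-hand side is a proper subterm of its left-hand side). The outermost symbol of a left-hand side is a destructor ($\delta$); other symbols are constructors ($f$). The Dolev–Yao closure $\mathfrak{F}(\psi)$ of a set of terms $\psi$ is the least set containing $\psi$, closed under application of constructors, and such that if $\delta$ is a destructor, $t_1,\dots,t_k\in\mathfrak{F}(\psi)$ and $\delta(t_1,\dots,t_k)\rightarrow t'$ then $t'\in\mathfrak{F}(\psi)$; $\psi\models\phi$ iff $\phi\subseteq\mathfrak{F}(\psi)$. Processes: $P,Q ::= \mathbf{0} \mid P \mid Q \mid (\nu n)P \mid \alpha.P \mid P+Q \mid \mathrm{let}\ x = T\ \mathrm{in}\ P$ with actions $\alpha ::= m(x) \mid m\langle T\rangle \mid m\langle * \rangle \mid [T_1 = T_2]$. Relevant subterms $sub(M)$: $sub(\delta(t_1,\dots,t_n)) = sub(t_1)\cup\dots\cup sub(t_n)$; $sub(n)=\{n\}$ for a name; $sub(x)=\emptyset$ for a variable; $sub(f(t_1,\dots,t_n)) = \{f(t_1,\dots,t_n)\}$ if no $t_i$ contains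 a variable or destructor, and $= sub(t_1)\cup\dots\cup sub(t_n)$ otherwise. For a set $\psi$ and name $n$, $\psi\uparrow n = \{t\in\psi : n\notin names(t)\}$. The relation $P\vdash_k\psi$ is the least relation with: $\mathbf{0}\vdash_k\emptyset$; if $P\vdash_k\varphi$ and $Q\vdash_k\psi$ then $P+Q\vdash_k\varphi\cup\psi$ and $P\mid Q\vdash_k\varphi\cup\psi$; if $P\vdash_k\varphi$ then $n(x).P\vdash_k\varphi$, $x\langle M\rangle.P\vdash_k\varphi\cup sub(M)$, $(\nu n)P\vdash_k\varphi\uparrow n$, and $[M=N].P\vdash_k\varphi\cup sub(M)\cup sub(N)$; if $P\{n\leftarrow M\}\vdash_k\varphi$ then $\mathrm{let}\ n = M\ \mathrm{in}\ P\vdash_k\varphi\cup sub(M)$. Satisfaction: $P\models\mathbb{K}\phi$ iff there is $\psi$ with $P\vdash_k\psi$ and $\psi\models\phi$. -}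

module Defs where

open import Data.Nat using (ℕ)
open import Data.Nat.Properties using () renaming (_≟_ to _≟ℕ_)
open import Data.Bool using (Bool; true; false; _∧_; _∨_; not; if_then_else_)
open import Data.List using (List; []; _∷_; _++_; filter)
open import Data.List.Membership.Propositional using (_∈_)
open import Data.List.Membership.DecPropositional _≟ℕ_ using () renaming (_∈?_ to _∈ℕ?_)
import Data.List.Relation.Unary.All as LAll
open import Data.Vec using (Vec; []; _∷_)
import Data.Vec.Relation.Unary.All as VAll
import Data.Vec.Membership.Propositional as VMem
open import Data.Product using (Σ; ∃; ∃₂; _×_; _,_)
open import Relation.Binary.PropositionalEquality using (_≡_)
open import Relation.Binary.Definitions using (DecidableEquality)
open import Relation.Nullary using (¬?; does)
open import Induction.WellFounded using (WellFounded)
open import Relation.Binary.Construct.Closure.ReflexiveTransitive using (Star)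

record Signature : Set₁ where
  field
    Sym   : Set
    arity : Sym → ℕ
    _≟S_  : DecidableEquality Sym
open Signature

module _ (S : Signature) where

  data Term : Set where
    name : ℕ → Term
    var  : ℕ → Term
    fun  : (f : Sym S) → Vec Term (arity S f) → Term

  mutual
    _·_ : Term → (ℕ → Term) → Term
    name n   · σ = name n
    var x    · σ = σ x
    fun f ts · σ = fun f (ts ·s σ)

    _·s_ : ∀ {k} → Vec Term k → (ℕ → Term) → Vec Term k
    []       ·s σ = []
    (t ∷ ts) ·s σ = (t · σ) ∷ (ts ·s σ)

  mutual
    names : Term → List ℕ
    names (name n)   = n ∷ []
    names (var x)    = []
    names (fun f ts) = namesV ts

    namesV : ∀ {k} → Vec Term k → List ℕ
    namesV []       = []
    namesV (t ∷ ts) = names t ++ namesV ts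

  data _⊑_ : Term → Term → Set
  data _⊏_ : Term → Term → Set
  data _⊑_ where
    ⊑-refl   : ∀ {t} → t ⊑ t
    ⊑-proper : ∀ {t u} → t ⊏ u → t ⊑ u
  data _⊏_ where
    ⊏-arg : ∀ {t u f} {ts : Vec Term (arity S f)} →
            t ⊑ u → u VMem.∈ ts → t ⊏ fun f ts

  Rule : Set
  Rule = Term × Term

  headIs : Sym S → Term → Bool
  headIs f (fun g _) = does (_≟S_ S f g)
  headIs f _         = false

module _ (S : Signature) (R : List (Rule S)) where

  data _⟶_ : Term S → Term S → Set
  data ArgStep : ∀ {k} → Vec (Term S) k → Vec (Term S) k → Set
  data _⟶_ where
    root : ∀ {l r} (σ : ℕ → Term S) → (l , r) ∈ R → _·_ S l σ ⟶ _·_ S r σ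
    arg  : ∀ {f} {ts us : Vec (Term S) (arity S f)} →
           ArgStep ts us → fun f ts ⟶ fun f us
  data ArgStep where
    here  : ∀ {k t u} {ts : Vec (Term S) k} → t ⟶ u → ArgStep (t ∷ ts) (u ∷ ts)
    there : ∀ {k t} {ts us : Vec (Term S) k} → ArgStep ts us → ArgStep (t ∷ ts) (t ∷ us)

  _⟶*_ : Term S → Term S → Set
  _⟶*_ = Star _⟶_

  Confluent : Set
  Confluent = ∀ {t u v} → t ⟶* u → t ⟶* v → ∃ λ w → (u ⟶* w) × (v ⟶* w)

  Terminating : Set
  Terminating = WellFounded (λ u t → t ⟶ u)

  Convergent : Set
  Convergent = Terminating × Confluent

  SubtermConvergent : Set
  SubtermConvergent = LAll.All (λ { (l , r) → _⊏_ S r l }) R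

  -- Destructors: outermost symbols of left-hand sides; others are constructors

  isDestructor : Sym S → Bool
  isDestructor f = go R
    where
    go : List (Rule S) → Bool
    go []             = false
    go ((l , r) ∷ rs) = headIs S f l ∨ go rs

  RootStep : Term S → Term S → Set
  RootStep u t' = ∃₂ λ l r → ((l , r) ∈ R) ×
                  (∃ λ σ → (_·_ S l σ ≡ u) × (_·_ S r σ ≡ t'))

  data DY (ψ : List (Term S)) : Term S → Set where
    base : ∀ {t} → t ∈ ψ → DY ψ t
    cons : ∀ {f} {ts : Vec (Term S) (arity S f)} →
           isDestructor f ≡ false → VAll.All (DY ψ) ts → DY ψ (fun f ts)
    dest : ∀ {δ t'} {ts : Vec (Term S) (arity S δ)} →
           isDestructor δ ≡ true → VAll.All (DY ψ) ts →
           RootStep (fun δ ts) t' → DY ψ t'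

  _⊨_ : List (Term S) → List (Term S) → Set
  ψ ⊨ φ = LAll.All (DY ψ) φ

  mutual
    clean : Term S → Bool
    clean (name n)   = true
    clean (var x)    = false
    clean (fun f ts) = not (isDestructor f) ∧ cleanV ts

    cleanV : ∀ {k} → Vec (Term S) k → Bool
    cleanV []       = true
    cleanV (t ∷ ts) = clean t ∧ cleanV ts

  mutual
    sub : Term S → List (Term S)
    sub (name n)   = name n ∷ []
    sub (var x)    = []
    sub (fun f ts) = if isDestructor f then subV ts
                     else (if cleanV ts then fun f ts ∷ [] else subV ts)

    subV : ∀ {k} → Vec (Term S) k → List (Term S)
    subV []       = []
    subV (t ∷ ts) = sub t ++ subV ts

  _↑_ : List (Term S) → ℕ → List (Term S)
  ψ ↑ n = filter (λ t → ¬? (n ∈ℕ? names S t)) ψ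

module _ (S : Signature) where

  data Action : Set where
    inp     : Term S → ℕ → Action
    out     : Term S → Term S → Action
    outStar : Term S → Action
    test    : Term S → Term S → Action

  data Proc : Set where
    𝟘     : Proc
    _∣_   : Proc → Proc → Proc
    ν     : ℕ → Proc → Proc
    _∙_   : Action → Proc → Proc
    _⊕_   : Proc → Proc → Proc
    letin : ℕ → Term S → Proc → Proc

  substT : ℕ → Term S → Term S → Term S
  substT x M t = _·_ S t (λ z → if does (z ≟ℕ x) then M else var z)

  substP : ℕ → Term S → Proc → Proc
  substP x M 𝟘            = 𝟘
  substP x M (P ∣ Q)      = substP x M P ∣ substP x M Q
  substP x M (ν n P)      = ν n (substP x M P)
  substP x M (inp m y ∙ P) =
    inp (substT x M m) y ∙ (if does (y ≟ℕ x) then P else substP x M P)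
  substP x M (out m T ∙ P) = out (substT x M m) (substT x M T) ∙ substP x M P
  substP x M (outStar m ∙ P) = outStar (substT x M m) ∙ substP x M P
  substP x M (test T U ∙ P) = test (substT x M T) (substT x M U) ∙ substP x M P
  substP x M (P ⊕ Q)      = substP x M P ⊕ substP x M Q
  substP x M (letin y T P) =
    letin y (substT x M T) (if does (y ≟ℕ x) then P else substP x M P)

module _ (S : Signature) (R : List (Rule S)) where

  data _⊢k_ : Proc S → List (Term S) → Set where
    k-nil  : 𝟘 ⊢k []
    k-sum  : ∀ {P Q φ ψ} → P ⊢k φ → Q ⊢k ψ → (P ⊕ Q) ⊢k (φ ++ ψ)
    k-par  : ∀ {P Q φ ψ} → P ⊢k φ → Q ⊢k ψ → (P ∣ Q) ⊢k (φ ++ ψ)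
    k-inp  : ∀ {P φ m x} → P ⊢k φ → (inp m x ∙ P) ⊢k φ
    k-out  : ∀ {P φ m M} → P ⊢k φ → (out m M ∙ P) ⊢k (φ ++ sub S R M)
    k-new  : ∀ {P φ n} → P ⊢k φ → ν n P ⊢k (_↑_ S R φ n)
    k-test : ∀ {P φ M N} → P ⊢k φ →
             (test M N ∙ P) ⊢k (φ ++ sub S R M ++ sub S R N)
    k-let  : ∀ {P φ x M} → substP S x M P ⊢k φ →
             letin x M P ⊢k (φ ++ sub S R M)

  _⊨𝕂_ : Proc S → List (Term S) → Set
  P ⊨𝕂 φ = ∃ λ ψ → (P ⊢k ψ) × (_⊨_ S R ψ φ)

-- (1) Extraction: ⊢k is a partial function of P (its rules are syntax directed),
--     and whether P has an extraction at all is decidable by recursion on the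
--     size of P, which substitution in the rule for let does not change.
--
-- (2) Deduction: for a fixed finite ψ, membership in the Dolev–Yao closure is
--     decidable. Saturate ψ by destructor steps whose results are subterms of ψ
--     (a finite universe U) and whose arguments are built from the current set
--     with constructors. Every such step is found by trying finitely many
--     substitutions with values in U, since values outside U can be clamped to a
--     known term without changing the step. Because the theory is subterm
--     convergent, every destructor result is a subterm of its arguments, so a
--     term is deducible from ψ iff it is built from the saturation by
--     constructors, which is decidable.

module Submission where

open import Defs
open import Data.List using (List)
open import Relation.Nullary using (Dec)

open import Data.Nat using (ℕ; suc; _+_; _≤_; _<_; z≤n; s≤s)
open import Data.Nat.Properties using (m≤n⇒m≤1+n; m≤m+n; m≤n+m; ≤-refl; ≤-reflexive)
  renaming (_≟_ to _≟ℕ_)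
open import Data.Nat.Induction using (<-wellFounded)
open import Data.Bool using (true; false; if_then_else_)
open import Data.Bool.Properties using () renaming (_≟_ to _≟B_)
open import Data.List using ([]; _∷_; _++_; concatMap; cartesianProductWith)
open import Data.List.Membership.Propositional using (_∈_; find; lose)
open import Data.List.Membership.Propositional.Properties
  using (∈-++⁺ˡ; ∈-++⁺ʳ; ∈-++⁻; ∈-cartesianProductWith⁺; ∈-concatMap⁺; ∈-concatMap⁻)
open import Data.List.Relation.Unary.Any using (Any; here; there; any?)
import Data.List.Relation.Unary.Any as Any
import Data.List.Relation.Unary.All as LAll
open import Data.List.Relation.Binary.Subset.Propositional using (_⊆_)
open import Data.Vec using (Vec; []; _∷_)
open import Data.Vec.Properties using (∷-injective)
import Data.Vec.Membership.Propositional as VMem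
import Data.Vec.Relation.Unary.Any as VAny
import Data.Vec.Relation.Unary.All as VAll
open import Data.Product using (Σ; ∃; _×_; _,_; proj₁; proj₂; uncurry)
open import Data.Sum using (_⊎_; inj₁; inj₂)
open import Data.Empty using (⊥; ⊥-elim)
open import Relation.Nullary using (yes; no; ¬_; ¬?; does)
open import Relation.Nullary.Decidable using (_×-dec_; map′; dec-true; dec-false)
open import Relation.Binary.PropositionalEquality
  using (_≡_; _≢_; refl; sym; trans; cong; cong₂; subst; module ≡-Reasoning)
open import Relation.Binary.Definitions using (DecidableEquality)
open import Induction.WellFounded using (Acc; acc)
open import Function using (_∘_)

open Signature

module Saturation {A : Set} (_≟_ : DecidableEquality A) (U : List A)
                  (Step : List A → A → Set) (step? : ∀ K s → Dec (Step K s))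
                  (Good : A → Set)
                  (good-step : ∀ {K s} → (∀ {k} → k ∈ K → Good k) → s ∈ U → Step K s → Good s)
                  where

  open import Data.List.Membership.DecPropositional _≟_ using (_∈?_)

  incUnless : ∀ {P : Set} → Dec P → ℕ → ℕ
  incUnless (yes _) n = n
  incUnless (no _)  n = suc n

  missing : List A → List A → ℕ
  missing K []       = 0
  missing K (u ∷ us) = incUnless (u ∈? K) (missing K us)

  incUnless-mono : ∀ {P Q : Set} {m n} (p? : Dec P) (q? : Dec Q) →
                      (Q → P) → m ≤ n → incUnless p? m ≤ incUnless q? n
  incUnless-mono (yes _) (yes _) _ m≤n = m≤n
  incUnless-mono (yes _) (no _)  _ m≤n = m≤n⇒m≤1+n m≤n
  incUnless-mono (no ¬p) (yes q) q→p _ = ⊥-elim (¬p (q→p q))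
  incUnless-mono (no _)  (no _)  _ m≤n = s≤s m≤n

  incUnless-mono-< : ∀ {P Q : Set} {m n} (p? : Dec P) (q? : Dec Q) →
                        (Q → P) → m < n → incUnless p? m < incUnless q? n
  incUnless-mono-< (yes _) (yes _) _ m<n = m<n
  incUnless-mono-< (yes _) (no _)  _ m<n = m≤n⇒m≤1+n m<n
  incUnless-mono-< (no ¬p) (yes q) q→p _ = ⊥-elim (¬p (q→p q))
  incUnless-mono-< (no _)  (no _)  _ m<n = s≤s m<n

  incUnless-< : ∀ {P Q : Set} {m n} (p? : Dec P) (q? : Dec Q) →
                   P → ¬ Q → m ≤ n → incUnless p? m < incUnless q? n
  incUnless-< (yes _) (no _)  _ _  m≤n = s≤s m≤n
  incUnless-< (no ¬p) _       p _  _   = ⊥-elim (¬p p)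
  incUnless-< (yes _) (yes q) _ ¬q _   = ⊥-elim (¬q q)

  missing-∷-≤ : ∀ s K us → missing (s ∷ K) us ≤ missing K us
  missing-∷-≤ s K []       = z≤n
  missing-∷-≤ s K (u ∷ us) =
    incUnless-mono (u ∈? (s ∷ K)) (u ∈? K) there (missing-∷-≤ s K us)

  missing-∷-< : ∀ {s} K us → s ∈ us → ¬ s ∈ K → missing (s ∷ K) us < missing K us
  missing-∷-< {s} K (u ∷ us) (here refl) s∉K =
    incUnless-< (u ∈? (s ∷ K)) (u ∈? K) (here refl) s∉K (missing-∷-≤ s K us)
  missing-∷-< {s} K (u ∷ us) (there s∈us) s∉K =
    incUnless-mono-< (u ∈? (s ∷ K)) (u ∈? K) there (missing-∷-< K us s∈us s∉K)

  record Saturated (K₀ : List A) : Set where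
    field
      carrier : List A
      extends : K₀ ⊆ carrier
      good    : ∀ {k} → k ∈ carrier → Good k
      closed  : ∀ {s} → s ∈ U → Step carrier s → s ∈ carrier

  drop-∷ : ∀ {s K} → Saturated (s ∷ K) → Saturated K
  drop-∷ sat = record { carrier = carrier ; extends = λ k∈K → extends (there k∈K)
                      ; good = good ; closed = closed }
    where open Saturated sat

  -- add some s ∈ U \ K with Step K s while one exists; the count of
  -- missing entries of U decreases with every addition
  saturate-acc : ∀ K → Acc _<_ (missing K U) → (∀ {k} → k ∈ K → Good k) → Saturated K
  saturate-acc K (acc smaller) good with any? (λ s → ¬? (s ∈? K) ×-dec step? K s) U
  ... | yes new with find new
  ...   | s , s∈U , s∉K , step = drop-∷ (saturate-acc (s ∷ K)
                                   (smaller (missing-∷-< K U s∈U s∉K)) good′)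
    where
    good′ : ∀ {k} → k ∈ s ∷ K → Good k
    good′ (here refl) = good-step good s∈U step
    good′ (there k∈K) = good k∈K
  saturate-acc K _ good | no nothing-new =
    record { carrier = K ; extends = λ k∈K → k∈K ; good = good ; closed = closed }
    where
    closed : ∀ {s} → s ∈ U → Step K s → s ∈ K
    closed {s} s∈U step with s ∈? K
    ... | yes s∈K = s∈K
    ... | no s∉K  = ⊥-elim (nothing-new (lose s∈U (s∉K , step)))

  saturate : ∀ K → (∀ {k} → k ∈ K → Good k) → Saturated K
  saturate K = saturate-acc K (<-wellFounded _)

module TermFacts (S : Signature) where

  T : Set
  T = Term S

  infixl 8 _⋯_ _⋯s_

  _⋯_ : T → (ℕ → T) → T
  t ⋯ σ = _·_ S t σ

  _⋯s_ : ∀ {k} → Vec T k → (ℕ → T) → Vec T k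
  ts ⋯s σ = _·s_ S ts σ

  infix 4 _≟T_ _≟V_

  mutual
    _≟T_ : DecidableEquality T
    name m   ≟T name n   = map′ (cong name) (λ { refl → refl }) (m ≟ℕ n)
    var x    ≟T var y    = map′ (cong var) (λ { refl → refl }) (x ≟ℕ y)
    fun f ts ≟T fun g us with _≟S_ S f g
    ... | yes refl = map′ (cong (fun f)) (λ { refl → refl }) (ts ≟V us)
    ... | no f≢g   = no λ { refl → f≢g refl }
    name _   ≟T var _    = no λ ()
    name _   ≟T fun _ _  = no λ ()
    var _    ≟T name _   = no λ ()
    var _    ≟T fun _ _  = no λ ()
    fun _ _  ≟T name _   = no λ ()
    fun _ _  ≟T var _    = no λ ()

    _≟V_ : ∀ {k} → DecidableEquality (Vec T k)
    []       ≟V []       = yes refl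
    (t ∷ ts) ≟V (u ∷ us) = map′ (uncurry (cong₂ _∷_)) ∷-injective (t ≟T u ×-dec ts ≟V us)

  mutual
    subs : T → List T
    subs t = t ∷ psubs t

    psubs : T → List T
    psubs (name _)   = []
    psubs (var _)    = []
    psubs (fun f ts) = subsV ts

    subsV : ∀ {k} → Vec T k → List T
    subsV []       = []
    subsV (t ∷ ts) = subs t ++ subsV ts

  subs-arg : ∀ {k t u} {ts : Vec T k} → u VMem.∈ ts → t ∈ subs u → t ∈ subsV ts
  subs-arg (VAny.here refl)              t∈u = ∈-++⁺ˡ t∈u
  subs-arg {ts = v ∷ _} (VAny.there u∈ts) t∈u = ∈-++⁺ʳ (subs v) (subs-arg u∈ts t∈u)

  mutual
    ⊑⇒∈subs : ∀ {t u} → _⊑_ S t u → t ∈ subs u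
    ⊑⇒∈subs ⊑-refl       = here refl
    ⊑⇒∈subs (⊑-proper p) = there (⊏⇒∈psubs p)

    ⊏⇒∈psubs : ∀ {t u} → _⊏_ S t u → t ∈ psubs u
    ⊏⇒∈psubs (⊏-arg t⊑u u∈ts) = subs-arg u∈ts (⊑⇒∈subs t⊑u)

  ⊏-inside : ∀ {r l} → _⊏_ S r l →
             ∃ λ g → Σ (Vec T (arity S g)) λ ls → l ≡ fun g ls × r ∈ subsV ls
  ⊏-inside r⊏l@(⊏-arg _ _) = _ , _ , refl , ⊏⇒∈psubs r⊏l

  mutual
    subs-trans : ∀ {u t} v → u ∈ subs t → t ∈ subs v → u ∈ subs v
    subs-trans v          u∈t (here refl) = u∈t
    subs-trans (fun f ts) u∈t (there t∈v) = there (subsV-trans ts u∈t t∈v)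

    subsV-trans : ∀ {k u t} (ts : Vec T k) → u ∈ subs t → t ∈ subsV ts → u ∈ subsV ts
    subsV-trans (v ∷ vs) u∈t t∈ts with ∈-++⁻ (subs v) t∈ts
    ... | inj₁ t∈v  = ∈-++⁺ˡ (subs-trans v u∈t t∈v)
    ... | inj₂ t∈vs = ∈-++⁺ʳ (subs v) (subsV-trans vs u∈t t∈vs)

  mutual
    subs-⋯ : ∀ {t} (σ : ℕ → T) u → t ∈ subs u → (t ⋯ σ) ∈ subs (u ⋯ σ)
    subs-⋯ σ u          (here refl) = here refl
    subs-⋯ σ (fun f ts) (there t∈ts) = there (subsV-⋯ σ ts t∈ts)

    subsV-⋯ : ∀ {k t} (σ : ℕ → T) (ts : Vec T k) → t ∈ subsV ts → (t ⋯ σ) ∈ subsV (ts ⋯s σ)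
    subsV-⋯ σ (v ∷ vs) t∈ts with ∈-++⁻ (subs v) t∈ts
    ... | inj₁ t∈v  = ∈-++⁺ˡ (subs-⋯ σ v t∈v)
    ... | inj₂ t∈vs = ∈-++⁺ʳ (subs (v ⋯ σ)) (subsV-⋯ σ vs t∈vs)

  mutual
    vars : T → List ℕ
    vars (name _)   = []
    vars (var y)    = y ∷ []
    vars (fun f ts) = varsV ts

    varsV : ∀ {k} → Vec T k → List ℕ
    varsV []       = []
    varsV (t ∷ ts) = vars t ++ varsV ts

  mutual
    ⋯-agree : ∀ {σ₁ σ₂ : ℕ → T} t → (∀ {y} → y ∈ vars t → σ₁ y ≡ σ₂ y) → t ⋯ σ₁ ≡ t ⋯ σ₂
    ⋯-agree (name _)   _     = refl
    ⋯-agree (var y)    agree = agree (here refl)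
    ⋯-agree (fun f ts) agree = cong (fun f) (⋯s-agree ts agree)

    ⋯s-agree : ∀ {k} {σ₁ σ₂ : ℕ → T} (ts : Vec T k) →
               (∀ {y} → y ∈ varsV ts → σ₁ y ≡ σ₂ y) → ts ⋯s σ₁ ≡ ts ⋯s σ₂
    ⋯s-agree []       _     = refl
    ⋯s-agree (t ∷ ts) agree =
      cong₂ _∷_ (⋯-agree t (agree ∘ ∈-++⁺ˡ)) (⋯s-agree ts (agree ∘ ∈-++⁺ʳ (vars t)))

  update : ℕ → T → (ℕ → T) → ℕ → T
  update x v σ y = if does (y ≟ℕ x) then v else σ y

  update-same : ∀ x v σ → update x v σ x ≡ v
  update-same x v σ = cong (λ b → if b then v else σ x) (dec-true (x ≟ℕ x) refl)

  update-other : ∀ {x y} v σ → y ≢ x → update x v σ y ≡ σ y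
  update-other {x} {y} v σ y≢x = cong (λ b → if b then v else σ y) (dec-false (y ≟ℕ x) y≢x)

  substitutionsInto : List T → List ℕ → List (ℕ → T)
  substitutionsInto U []       = var ∷ []
  substitutionsInto U (x ∷ xs) = cartesianProductWith (update x) U (substitutionsInto U xs)

  substitutionsInto-complete : ∀ U xs (τ : ℕ → T) → (∀ {y} → y ∈ xs → τ y ∈ U) →
    ∃ λ σ → σ ∈ substitutionsInto U xs × (∀ {y} → y ∈ xs → σ y ≡ τ y)
  substitutionsInto-complete U []       τ _    = var , here refl , λ ()
  substitutionsInto-complete U (x ∷ xs) τ τ∈U
    with substitutionsInto-complete U xs τ (τ∈U ∘ there)
  ... | σ , σ∈ , σ≈τ =
    update x (τ x) σ , ∈-cartesianProductWith⁺ (update x) (τ∈U (here refl)) σ∈ , agrees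
    where
    agrees : ∀ {y} → y ∈ x ∷ xs → update x (τ x) σ y ≡ τ y
    agrees {y} y∈ with y ≟ℕ x | y∈
    ... | yes refl | _          = update-same x (τ x) σ
    ... | no y≢x   | here y≡x   = ⊥-elim (y≢x y≡x)
    ... | no y≢x   | there y∈xs = trans (update-other (τ x) σ y≢x) (σ≈τ y∈xs)

module ConstructorClosure (S : Signature) (R : List (Rule S)) where
  open TermFacts S
  open import Data.List.Membership.DecPropositional _≟T_ using (_∈?_)

  data Built (K : List T) : T → Set where
    inK : ∀ {t} → t ∈ K → Built K t
    con : ∀ {f} {ts : Vec T (arity S f)} →
          isDestructor S R f ≡ false → VAll.All (Built K) ts → Built K (fun f ts)

  mutual
    built? : (K : List T) (t : T) → Dec (Built K t)
    built? K t with t ∈? K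
    ... | yes t∈K = yes (inK t∈K)
    ... | no t∉K  = built-outside? K t t∉K

    built-outside? : (K : List T) (t : T) → ¬ t ∈ K → Dec (Built K t)
    built-outside? K (name _)   t∉K = no λ { (inK t∈K) → t∉K t∈K }
    built-outside? K (var _)    t∉K = no λ { (inK t∈K) → t∉K t∈K }
    built-outside? K (fun f ts) t∉K with isDestructor S R f in isD
    ... | true  = no λ { (inK t∈K) → t∉K t∈K ; (con isC _) → true≢false (trans (sym isD) isC) }
      where
      true≢false : true ≢ false
      true≢false ()
    ... | false = map′ (con isD) (λ { (inK t∈K) → ⊥-elim (t∉K t∈K) ; (con _ args) → args })
                       (builtAll? K ts)

    builtAll? : ∀ {k} (K : List T) (ts : Vec T k) → Dec (VAll.All (Built K) ts)
    builtAll? K []       = yes VAll.[]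
    builtAll? K (t ∷ ts) = map′ (uncurry VAll._∷_) VAll.uncons (built? K t ×-dec builtAll? K ts)

  mutual
    built-subterm : ∀ {K u t} → Built K u → t ∈ subs u →
                    Built K t ⊎ ∃ λ k → k ∈ K × t ∈ subs k
    built-subterm {u = u} (inK u∈K) t∈u            = inj₂ (u , u∈K , t∈u)
    built-subterm b@(con _ _)       (here refl)    = inj₁ b
    built-subterm (con _ args)      (there t∈args) = builtAll-subterm args t∈args

    builtAll-subterm : ∀ {K n t} {ts : Vec T n} → VAll.All (Built K) ts → t ∈ subsV ts →
                       Built K t ⊎ ∃ λ k → k ∈ K × t ∈ subs k
    builtAll-subterm {ts = v ∷ _} (b VAll.∷ bs) t∈ts with ∈-++⁻ (subs v) t∈ts
    ... | inj₁ t∈v  = built-subterm b t∈v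
    ... | inj₂ t∈vs = builtAll-subterm bs t∈vs

  mutual
    built-sound : ∀ {ψ K t} → (∀ {k} → k ∈ K → DY S R ψ k) → Built K t → DY S R ψ t
    built-sound K⊆DY (inK t∈K)   = K⊆DY t∈K
    built-sound K⊆DY (con isC a) = cons isC (builtAll-sound K⊆DY a)

    builtAll-sound : ∀ {ψ K n} {ts : Vec T n} → (∀ {k} → k ∈ K → DY S R ψ k) →
                     VAll.All (Built K) ts → VAll.All (DY S R ψ) ts
    builtAll-sound K⊆DY VAll.[]       = VAll.[]
    builtAll-sound K⊆DY (b VAll.∷ bs) = built-sound K⊆DY b VAll.∷ builtAll-sound K⊆DY bs

module DestructorSteps (S : Signature) (R : List (Rule S)) (U : List (Term S))
                       (U-down : ∀ {u t} → u ∈ TermFacts.subs S t → t ∈ U → u ∈ U) where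
  open TermFacts S
  open ConstructorClosure S R
  open import Data.List.Membership.DecPropositional _≟T_ using (_∈?_)

  Fires : List T → T → Rule S → (ℕ → T) → Set
  Fires K s (fun δ ls , r) σ =
    isDestructor S R δ ≡ true × VAll.All (Built K) (ls ⋯s σ) × r ⋯ σ ≡ s
  Fires K s (name _ , _) σ = ⊥
  Fires K s (var _ , _)  σ = ⊥

  fires? : ∀ K s ρ σ → Dec (Fires K s ρ σ)
  fires? K s (fun δ ls , r) σ =
    isDestructor S R δ ≟B true ×-dec builtAll? K (ls ⋯s σ) ×-dec (r ⋯ σ) ≟T s
  fires? K s (name _ , _) σ = no λ ()
  fires? K s (var _ , _)  σ = no λ ()

  ruleVars : Rule S → List ℕ
  ruleVars (l , r) = vars l ++ vars r

  Step : List T → T → Set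
  Step K s = Any (λ ρ → Any (Fires K s ρ) (substitutionsInto U (ruleVars ρ))) R

  step? : ∀ K s → Dec (Step K s)
  step? K s = any? (λ ρ → any? (fires? K s ρ) (substitutionsInto U (ruleVars ρ))) R

  step-sound : ∀ {ψ K s} → (∀ {k} → k ∈ K → DY S R ψ k) → Step K s → DY S R ψ s
  step-sound K⊆DY step with find step
  ... | (name _ , _) , _ , fires = ⊥-elim (proj₂ (proj₂ (find fires)))
  ... | (var _ , _)  , _ , fires = ⊥-elim (proj₂ (proj₂ (find fires)))
  ... | (fun δ ls , r) , ρ∈R , fires with find fires
  ...   | σ , _ , isδ , args , r≡s =
    dest isδ (builtAll-sound K⊆DY args) (fun δ ls , r , ρ∈R , σ , refl , r≡s)

  -- Restricting a substitution to U: the values of σ outside U are replaced by a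
  -- fixed w ∈ K. This leaves instances inside U unchanged and keeps built terms built.
  module Clamp (K : List T) (K⊆U : ∀ {k} → k ∈ K → k ∈ U) {w : T} (w∈K : w ∈ K)
               (σ : ℕ → T) where

    clamped : ℕ → T
    clamped y with σ y ∈? U
    ... | yes _ = σ y
    ... | no _  = w

    clamped∈U : ∀ y → clamped y ∈ U
    clamped∈U y with σ y ∈? U
    ... | yes σy∈U = σy∈U
    ... | no _     = K⊆U w∈K

    mutual
      clamped-fixes : ∀ t → (∀ {u} → u ∈ subs (t ⋯ σ) → u ∈ U) → t ⋯ clamped ≡ t ⋯ σ
      clamped-fixes (name _)   _    = refl
      clamped-fixes (var y)    inU with σ y ∈? U
      ... | yes _    = refl
      ... | no σy∉U = ⊥-elim (σy∉U (inU (here refl)))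
      clamped-fixes (fun f ts) inU = cong (fun f) (clampedAll-fixes ts (inU ∘ there))

      clampedAll-fixes : ∀ {n} (ts : Vec T n) → (∀ {u} → u ∈ subsV (ts ⋯s σ) → u ∈ U) →
                         ts ⋯s clamped ≡ ts ⋯s σ
      clampedAll-fixes []       _   = refl
      clampedAll-fixes (t ∷ ts) inU = cong₂ _∷_ (clamped-fixes t (inU ∘ ∈-++⁺ˡ))
                                        (clampedAll-fixes ts (inU ∘ ∈-++⁺ʳ (subs (t ⋯ σ))))

    clamped-fixes-U : ∀ t → t ⋯ σ ∈ U → t ⋯ clamped ≡ t ⋯ σ
    clamped-fixes-U t tσ∈U = clamped-fixes t (λ u∈ → U-down u∈ tσ∈U)

    mutual
      clamped-built : ∀ t → Built K (t ⋯ σ) → Built K (t ⋯ clamped)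
      clamped-built (name _)   b = b
      clamped-built (var y)    b with σ y ∈? U
      ... | yes _ = b
      ... | no _  = inK w∈K
      clamped-built (fun f ts) (inK tσ∈K) =
        subst (Built K) (sym (clamped-fixes-U (fun f ts) (K⊆U tσ∈K))) (inK tσ∈K)
      clamped-built (fun f ts) (con isC args) = con isC (clampedAll-built ts args)

      clampedAll-built : ∀ {n} (ts : Vec T n) →
                         VAll.All (Built K) (ts ⋯s σ) → VAll.All (Built K) (ts ⋯s clamped)
      clampedAll-built []       _             = VAll.[]
      clampedAll-built (t ∷ ts) (b VAll.∷ bs) = clamped-built t b VAll.∷ clampedAll-built ts bs

    step-complete : ∀ {δ ls r} → (fun δ ls , r) ∈ R → isDestructor S R δ ≡ true →
                    VAll.All (Built K) (ls ⋯s σ) → r ⋯ σ ∈ U → Step K (r ⋯ σ)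
    step-complete {δ} {ls} {r} ρ∈R isδ args rσ∈U
      with substitutionsInto-complete U (ruleVars (fun δ ls , r)) clamped (λ {y} _ → clamped∈U y)
    ... | τ , τ∈ , τ≈clamped = lose ρ∈R (lose τ∈ (isδ , args′ , rτ≡rσ))
      where
      args′ : VAll.All (Built K) (ls ⋯s τ)
      args′ = subst (VAll.All (Built K)) (⋯s-agree ls (λ y∈ → sym (τ≈clamped (∈-++⁺ˡ y∈))))
                    (clampedAll-built ls args)
      open ≡-Reasoning
      rτ≡rσ : r ⋯ τ ≡ r ⋯ σ
      rτ≡rσ = begin
        r ⋯ τ       ≡⟨ ⋯-agree r (λ y∈ → τ≈clamped (∈-++⁺ʳ (varsV ls) y∈)) ⟩
        r ⋯ clamped ≡⟨ clamped-fixes-U r rσ∈U ⟩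
        r ⋯ σ       ∎

module Deduction (S : Signature) (R : List (Rule S)) (sc : SubtermConvergent S R)
                 (ψ : List (Term S)) where
  open TermFacts S
  open ConstructorClosure S R

  U : List T
  U = concatMap subs ψ

  U-down : ∀ {u t} → u ∈ subs t → t ∈ U → u ∈ U
  U-down u∈t t∈U =
    ∈-concatMap⁺ subs {xs = ψ} (Any.map (subs-trans _ u∈t) (∈-concatMap⁻ subs {xs = ψ} t∈U))

  ψ⊆U : ∀ {k} → k ∈ ψ → k ∈ U
  ψ⊆U k∈ψ = ∈-concatMap⁺ subs (Any.map (λ { refl → here refl }) k∈ψ)

  open DestructorSteps S R U U-down

  Good : T → Set
  Good t = DY S R ψ t × t ∈ U

  open Saturation _≟T_ U Step step? Good
         (λ K⊆Good s∈U step → step-sound (proj₁ ∘ K⊆Good) step , s∈U)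

  saturation : Saturated ψ
  saturation = saturate ψ (λ k∈ψ → base k∈ψ , ψ⊆U k∈ψ)

  open Saturated saturation renaming (carrier to Kψ)

  -- For a destructor step δ(ts) → rσ the
  -- right-hand side r is a proper subterm of the left-hand side, so rσ is a
  -- subterm of the built arguments: either built itself, or a subterm of Kψ,
  -- hence in U and, by closure of the saturation, in Kψ.
  mutual
    deducible⇒built : ∀ {t} → DY S R ψ t → Built Kψ t
    deducible⇒built (base t∈ψ)    = inK (extends t∈ψ)
    deducible⇒built (cons isC ds) = con isC (deducibleAll⇒built ds)
    deducible⇒built (dest isδ ds (l , r , ρ∈R , σ , lσ≡ , refl))
      with ⊏-inside (LAll.lookup sc ρ∈R)
    ... | δ , ls , refl , r∈ls with lσ≡
    ...   | refl with builtAll-subterm (deducibleAll⇒built ds) (subsV-⋯ σ ls r∈ls)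
    ...     | inj₁ rσ-built          = rσ-built
    ...     | inj₂ (k , k∈Kψ , rσ∈k) = inK (closed rσ∈U
        (Clamp.step-complete Kψ (proj₂ ∘ good) k∈Kψ σ ρ∈R isδ (deducibleAll⇒built ds) rσ∈U))
      where
      rσ∈U : r ⋯ σ ∈ U
      rσ∈U = U-down rσ∈k (proj₂ (good k∈Kψ))

    deducibleAll⇒built : ∀ {n} {ts : Vec T n} →
                         VAll.All (DY S R ψ) ts → VAll.All (Built Kψ) ts
    deducibleAll⇒built VAll.[]       = VAll.[]
    deducibleAll⇒built (d VAll.∷ ds) = deducible⇒built d VAll.∷ deducibleAll⇒built ds

  -- Kψ consists of deducible terms, so deducibility coincides with being built from Kψ
  deducible? : ∀ t → Dec (DY S R ψ t)
  deducible? t = map′ (built-sound (proj₁ ∘ good)) deducible⇒built (built? Kψ t)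

  entails? : ∀ φ → Dec (_⊨_ S R ψ φ)
  entails? = LAll.all? deducible?

module Extraction (S : Signature) (R : List (Rule S)) where

  _⊢_ : Proc S → List (Term S) → Set
  _⊢_ = _⊢k_ S R

  -- the rules of ⊢k are syntax directed, so the extracted set is unique
  ⊢-functional : ∀ {P φ ψ} → P ⊢ φ → P ⊢ ψ → φ ≡ ψ
  ⊢-functional k-nil        k-nil          = refl
  ⊢-functional (k-sum d e)  (k-sum d′ e′)  = cong₂ _++_ (⊢-functional d d′) (⊢-functional e e′)
  ⊢-functional (k-par d e)  (k-par d′ e′)  = cong₂ _++_ (⊢-functional d d′) (⊢-functional e e′)
  ⊢-functional (k-inp d)    (k-inp d′)     = ⊢-functional d d′
  ⊢-functional (k-out d)    (k-out d′)     = cong (_++ _) (⊢-functional d d′)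
  ⊢-functional {ν n _} (k-new d) (k-new d′) = cong (λ φ → _↑_ S R φ n) (⊢-functional d d′)
  ⊢-functional (k-test d)   (k-test d′)    = cong (_++ _) (⊢-functional d d′)
  ⊢-functional (k-let d)    (k-let d′)     = cong (_++ _) (⊢-functional d d′)

  -- number of process constructors; substitution preserves it, so it
  -- decreases along every premise of ⊢k, including the one for let
  size : Proc S → ℕ
  size 𝟘             = 0
  size (P ∣ Q)       = suc (size P + size Q)
  size (ν _ P)       = suc (size P)
  size (_ ∙ P)       = suc (size P)
  size (P ⊕ Q)       = suc (size P + size Q)
  size (letin _ _ P) = suc (size P)

  size-if : ∀ b {P Q} → size Q ≡ size P → size (if b then P else Q) ≡ size P
  size-if true  _   = refl
  size-if false Q≡P = Q≡P

  size-substP : ∀ x M P → size (substP S x M P) ≡ size P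
  size-substP x M 𝟘                = refl
  size-substP x M (P ∣ Q)          = cong₂ (λ m n → suc (m + n)) (size-substP x M P) (size-substP x M Q)
  size-substP x M (ν _ P)          = cong suc (size-substP x M P)
  size-substP x M (inp _ y ∙ P)    = cong suc (size-if (does (y ≟ℕ x)) (size-substP x M P))
  size-substP x M (out _ _ ∙ P)    = cong suc (size-substP x M P)
  size-substP x M (outStar _ ∙ P)  = cong suc (size-substP x M P)
  size-substP x M (test _ _ ∙ P)   = cong suc (size-substP x M P)
  size-substP x M (P ⊕ Q)          = cong₂ (λ m n → suc (m + n)) (size-substP x M P) (size-substP x M Q)
  size-substP x M (letin y _ P)    = cong suc (size-if (does (y ≟ℕ x)) (size-substP x M P))

  Extractable : Proc S → Set
  Extractable P = ∃ (P ⊢_)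

  extractable-acc? : ∀ P → Acc _<_ (size P) → Dec (Extractable P)
  extractable-acc? 𝟘 _ = yes ([] , k-nil)
  extractable-acc? (P ∣ Q) (acc smaller) =
    map′ (λ ((φ , d) , (ψ , e)) → φ ++ ψ , k-par d e) (λ { (_ , k-par d e) → (_ , d) , (_ , e) })
         (extractable-acc? P (smaller (s≤s (m≤m+n _ _))) ×-dec
          extractable-acc? Q (smaller (s≤s (m≤n+m _ (size P)))))
  extractable-acc? (P ⊕ Q) (acc smaller) =
    map′ (λ ((φ , d) , (ψ , e)) → φ ++ ψ , k-sum d e) (λ { (_ , k-sum d e) → (_ , d) , (_ , e) })
         (extractable-acc? P (smaller (s≤s (m≤m+n _ _))) ×-dec
          extractable-acc? Q (smaller (s≤s (m≤n+m _ (size P)))))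
  extractable-acc? (ν n P) (acc smaller) =
    map′ (λ (φ , d) → _ , k-new d) (λ { (_ , k-new d) → _ , d }) (extractable-acc? P (smaller ≤-refl))
  extractable-acc? (inp _ _ ∙ P) (acc smaller) =
    map′ (λ (φ , d) → _ , k-inp d) (λ { (_ , k-inp d) → _ , d }) (extractable-acc? P (smaller ≤-refl))
  extractable-acc? (out _ _ ∙ P) (acc smaller) =
    map′ (λ (φ , d) → _ , k-out d) (λ { (_ , k-out d) → _ , d }) (extractable-acc? P (smaller ≤-refl))
  extractable-acc? (outStar _ ∙ P) _ = no λ ()
  extractable-acc? (test _ _ ∙ P) (acc smaller) =
    map′ (λ (φ , d) → _ , k-test d) (λ { (_ , k-test d) → _ , d }) (extractable-acc? P (smaller ≤-refl))
  extractable-acc? (letin x M P) (acc smaller) =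
    map′ (λ (φ , d) → _ , k-let d) (λ { (_ , k-let d) → _ , d })
         (extractable-acc? (substP S x M P) (smaller (s≤s (≤-reflexive (size-substP x M P)))))

  extractable? : ∀ P → Dec (Extractable P)
  extractable? P = extractable-acc? P (<-wellFounded (size P))

mainTheorem6 : (S : Signature) (R : List (Rule S)) →
    Convergent S R → SubtermConvergent S R →
    (P : Proc S) (φ : List (Term S)) → Dec (_⊨𝕂_ S R P φ)
mainTheorem6 S R _ sc P φ with Extraction.extractable? S R P
... | no  ∄ψ        = no λ (ψ , P⊢ψ , _) → ∄ψ (ψ , P⊢ψ)
... | yes (ψ , P⊢ψ) = map′ (λ ψ⊨φ → ψ , P⊢ψ , ψ⊨φ) only-ψ (Deduction.entails? S R sc ψ φ)
  where
  only-ψ : _⊨𝕂_ S R P φ → _⊨_ S R ψ φ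
  only-ψ (ψ′ , P⊢ψ′ , ψ′⊨φ) =
    subst (λ χ → _⊨_ S R χ φ) (Extraction.⊢-functional S R P⊢ψ′ P⊢ψ) ψ′⊨φ
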